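{- Let $k\ge 3$, $0<p<1$, and $G\sim\mathcal{G}(n,p)$. For every graph $F$ without isolated vertices with $3\le v(F)\le k$ and every pair $1\le i<j\le n$, we have $\mathbb{E}[S_{ij}(F,G)]=0$ and $\mathbb{E}[S_{ij}(F,G)^2]\le k^2p^{e(F)-1}n^{v(F)-2}$.
   Context: $\mathcal{G}(n,p)$ is the Erdős–Rényi random graph on vertex set $[n]$ with edge probability $p$. For a graph $G$ and a pair $e$ of vertices, $I_G(e)$ is the indicator that $e\in E(G)$. For a graph $F$, $S(F,G):=\sum_{F'}\prod_{e\in E(F')}(I_G(e)-p)$, the sum over all graphs $F'$ isomorphic to $F$ with $V(F')\subseteq V(G)$ (not required to be subgraphs of $G$). For a pair $ij$ of vertices, $S_{ij}(F,G):=S(F,G\cup\{ij\})-S(F,G\setminus\{ij\})$, where $G\cup\{ij\}$ and $G\setminus\{ij\}$ are obtained from $G$ by adding, respectively removing, the edge $ij$.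
   Formalization: The edge probability p is a rational number with $0<p<1$. -}

module Defs where

open import Data.Bool using (Bool; true; false; if_then_else_; _∧_; _∨_)
import Data.Bool as B
open import Data.Nat as ℕ using (ℕ; zero; suc)
open import Data.Fin as Fin using (Fin; toℕ)
open import Data.Fin.Properties using () renaming (_≟_ to _≟ᶠ_)
open import Data.List using (List; []; _∷_; map; filter; concatMap; foldr; allFin; zip; _++_)
open import Data.Bool.ListAction using (any)
import Data.List.Properties as LP
import Data.Product.Properties as PP
open import Data.Product using (_×_; _,_; proj₁; proj₂; Σ; ∃)
open import Data.Rational using (ℚ; 0ℚ; 1ℚ; _+_; _*_; _-_)
import Data.Integer
import Data.Rational
open import Relation.Binary.PropositionalEquality using (_≡_)
open import Relation.Nullary.Decidable using (⌊_⌋)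

infixr 8 _^ℚ_
_^ℚ_ : ℚ → ℕ → ℚ
q ^ℚ zero  = 1ℚ
q ^ℚ suc m = q * (q ^ℚ m)

sumℚ : List ℚ → ℚ
sumℚ = foldr _+_ 0ℚ

prodℚ : List ℚ → ℚ
prodℚ = foldr _*_ 1ℚ

fromℕℚ : ℕ → ℚ
fromℕℚ m = Data.Integer.+ m Data.Rational./ 1

-- Vertex pairs.  A pair {a,b} of distinct vertices of [m] is encoded by
-- (a , b) with a < b;  Pairs m lists all of them, each exactly once.

Pairs : (m : ℕ) → List (Fin m × Fin m)
Pairs m = concatMap (λ a → map (λ b → (a , b))
                      (filter (λ b → toℕ a ℕ.<? toℕ b) (allFin m)))
                    (allFin m)

_≡ᶠ_ : ∀ {m} → Fin m → Fin m → Bool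
a ≡ᶠ b = ⌊ a ≟ᶠ b ⌋

-- A (labelled) graph on vertex set [n] = Fin n is given by its edge
-- indicator on pairs: the pair {a,b} with a < b is an edge iff  G a b ≡ true.
-- (Values G a b with a ≥ b are ignored.)

Graph : ℕ → Set
Graph n = Fin n → Fin n → Bool

I : ∀ {n} → Graph n → Fin n × Fin n → Bool
I G (a , b) = G a b

-- G ∪ {ij} and G ∖ {ij}  (for i < j)
addEdge : ∀ {n} → Graph n → Fin n → Fin n → Graph n
addEdge G i j a b = if (a ≡ᶠ i) ∧ (b ≡ᶠ j) then true else G a b

removeEdge : ∀ {n} → Graph n → Fin n → Fin n → Graph n
removeEdge G i j a b = if (a ≡ᶠ i) ∧ (b ≡ᶠ j) then false else G a b

record SimpleGraph (v : ℕ) : Set where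
  field
    adj    : Fin v → Fin v → Bool
    sym    : ∀ a b → adj a b ≡ adj b a
    irrefl : ∀ a → adj a a ≡ false
open SimpleGraph public

edgesF : ∀ {v} → SimpleGraph v → List (Fin v × Fin v)
edgesF F = filter (λ e → B.T? (adj F (proj₁ e) (proj₂ e))) (Pairs _)

eF : ∀ {v} → SimpleGraph v → ℕ
eF F = Data.List.length (edgesF F)

NoIsolatedVertices : ∀ {v} → SimpleGraph v → Set
NoIsolatedVertices {v} F = ∀ (a : Fin v) → ∃ λ (b : Fin v) → adj F a b ≡ true

-- Copies F' of F with V(F') ⊆ [n].
-- Every such F' is the image of F under an injection φ : Fin v → Fin n,
-- and conversely.  A copy is recorded canonically as
--   (vertex indicator over allFin n , edge indicator over Pairs n),
-- and the list of copies is the deduplicated list of images of all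
-- injections, so each graph F' isomorphic to F occurs exactly once.

allMaps : (v n : ℕ) → List (Fin v → Fin n)
allMaps zero    n = (λ ()) ∷ []
allMaps (suc v) n =
  concatMap (λ x → map (λ f → cons′ x f) (allMaps v n)) (allFin n)
  where
  cons′ : ∀ {v n} → Fin n → (Fin v → Fin n) → Fin (suc v) → Fin n
  cons′ x f Fin.zero    = x
  cons′ x f (Fin.suc c) = f c

isInjective : ∀ {v n} → (Fin v → Fin n) → Bool
isInjective {v} φ =
  B.not (any (λ e → φ (proj₁ e) ≡ᶠ φ (proj₂ e)) (Pairs v))

injections : (v n : ℕ) → List (Fin v → Fin n)
injections v n = filter (λ φ → B.T? (isInjective φ)) (allMaps v n)

Copy : ℕ → Set
Copy n = List Bool × List Bool

image : ∀ {v n} → SimpleGraph v → (Fin v → Fin n) → Copy n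
image {v} {n} F φ =
  ( map (λ a → any (λ c → φ c ≡ᶠ a) (allFin v)) (allFin n)
  , map (λ e → any (λ f → ((φ (proj₁ f) ≡ᶠ proj₁ e) ∧ (φ (proj₂ f) ≡ᶠ proj₂ e))
                        ∨ ((φ (proj₁ f) ≡ᶠ proj₂ e) ∧ (φ (proj₂ f) ≡ᶠ proj₁ e)))
                   (edgesF F))
        (Pairs n) )

copies : ∀ {v} → SimpleGraph v → (n : ℕ) → List (Copy n)
copies {v} F n =
  Data.List.deduplicate
    (PP.≡-dec (LP.≡-dec B._≟_) (LP.≡-dec B._≟_))
    (map (image F) (injections v n))

indℚ : Bool → ℚ
indℚ true  = 1ℚ
indℚ false = 0ℚ

copyWeight : ∀ {n} → ℚ → Graph n → Copy n → ℚ
copyWeight {n} p G (_ , es) =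
  prodℚ (map (λ eb → if proj₂ eb then indℚ (I G (proj₁ eb)) - p else 1ℚ)
             (zip (Pairs n) es))

S : ∀ {v n} → ℚ → SimpleGraph v → Graph n → ℚ
S {n = n} p F G = sumℚ (map (copyWeight p G) (copies F n))

Sij : ∀ {v n} → ℚ → SimpleGraph v → Graph n → Fin n → Fin n → ℚ
Sij p F G i j = S p F (addEdge G i j) - S p F (removeEdge G i j)

-- The random graph G(n,p) and expectation.
-- Graphs on [n] correspond exactly to subsets L of Pairs n.

sublists : ∀ {A : Set} → List A → List (List A)
sublists []       = [] ∷ []
sublists (x ∷ xs) = map (x ∷_) (sublists xs) ++ sublists xs

graphOf : ∀ {n} → List (Fin n × Fin n) → Graph n
graphOf L a b = any (λ e → (proj₁ e ≡ᶠ a) ∧ (proj₂ e ≡ᶠ b)) L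

allGraphs : (n : ℕ) → List (Graph n)
allGraphs n = map graphOf (sublists (Pairs n))

probG : ∀ {n} → ℚ → Graph n → ℚ
probG {n} p G = prodℚ (map (λ e → if I G e then p else 1ℚ - p) (Pairs n))

𝔼 : (n : ℕ) → ℚ → (Graph n → ℚ) → ℚ
𝔼 n p X = sumℚ (map (λ G → probG p G * X G) (allGraphs n))

{-# OPTIONS --safe #-}
module Submission where

-- S_ij(F,G) is the sum over the copies F' of F of ∂_F'(G), the product ∏_{e ∈ F'} (I_G(e) - p)
-- taken with I(ij) = 1 minus the same product taken with I(ij) = 0; it is ∏_{e ∈ F' - ij} (I_G(e) - p)
-- if ij ∈ F' and 0 otherwise. The edges of G(n,p) are independent, so the expectation of such a
-- product factors over the pairs of [n], and a factor I_G(e) - p has mean 0. Since v(F) ≥ 3 and F has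
-- no isolated vertex, every copy has an edge other than ij, whence 𝔼 S_ij = 0. Two distinct copies
-- differ in some edge (a copy without isolated vertices is determined by its edges), so
-- 𝔼[∂_F' ∂_F''] = 0, while 𝔼[∂_F'²] ≤ p^(e(F)-1) because each of the e(F) - 1 edges other than ij
-- contributes p(1 - p) ≤ p. Finally a copy containing ij is the image of a map sending two of the
-- v(F) vertices to i and j, and there are at most v(F)² n^(v(F)-2) ≤ k² n^(v(F)-2) such maps.

open import Defs hiding (sym)
open import Data.Nat using (ℕ; _≤_; _∸_)
open import Data.Fin using (Fin; _<_)
open import Data.Product using (_×_)
open import Data.Rational using (ℚ; 0ℚ; 1ℚ; _*_) renaming (_<_ to _<ℚ_; _≤_ to _≤ℚ_)
open import Relation.Binary.PropositionalEquality using (_≡_)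

open import Data.Bool using (Bool; true; false; if_then_else_; not; _∧_; _∨_; T; T?)
import Data.Bool as Bool
open import Data.Bool.ListAction using (any; or)
open import Data.Bool.Properties using (T-≡; T-not-≡; T-∧; T-∨)
open import Data.Empty using (⊥-elim)
open import Data.Fin using (zero; suc; toℕ)
open import Data.Fin.Properties using (toℕ-injective; <⇒≢) renaming (_≟_ to _≟ᶠ_)
import Data.Integer as ℤ
import Data.Integer.Properties as ℤ
open import Data.List using (List; []; _∷_; map; _++_; length; allFin; concatMap; filter; deduplicate; zip)
open import Data.List.Properties using (map-cong; map-cong-local; length-map; length-tabulate; map-++; map-∘)
open import Data.List.Membership.Propositional using (_∈_; find; lose)
open import Data.List.Membership.Propositional.Properties
  using (∈-allFin; ∈-map⁺; ∈-map⁻; ∈-filter⁺; ∈-filter⁻; ∈-concatMap⁺; ∈-concatMap⁻)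
open import Data.List.Relation.Unary.All as All using (All; []; _∷_)
import Data.List.Relation.Unary.All.Properties as AllP
open import Data.List.Relation.Unary.AllPairs using ([]; _∷_)
open import Data.List.Relation.Unary.Any as Any using (Any; here; there)
open import Data.List.Relation.Unary.Any.Properties using (any⁺; any⁻)
open import Data.List.Relation.Unary.Unique.Propositional using (Unique)
import Data.List.Relation.Unary.Unique.Propositional.Properties as Unique
open import Data.List.Relation.Unary.Unique.DecPropositional.Properties using (deduplicate-!)
open import Data.Nat as ℕ using (zero; suc; z≤n; s≤s)
import Data.Nat.Properties as ℕ
open import Data.Nat.ListAction using (sum)
open import Data.Product using (∃-syntax; _,_; proj₁; proj₂; swap)
open import Data.Rational using (_+_; _-_; -_; toℚᵘ; nonNegative)
import Data.Rational.Properties as ℚ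
open import Data.Rational.Solver using (module +-*-Solver)
open import Data.Rational.Unnormalised as ℚᵘ using (mkℚᵘ)
import Data.Rational.Unnormalised.Properties as ℚᵘ
open import Data.Sum using (_⊎_; inj₁; inj₂; [_,_])
open import Function using (_∘_; Equivalence)
open import Relation.Binary using (DecidableEquality) renaming (Decidable to Decidable₂)
open import Relation.Binary.PropositionalEquality
  using (refl; sym; trans; cong; cong₂; subst; subst₂; _≢_; module ≡-Reasoning)
open import Relation.Nullary using (¬_; yes; no; does)
open import Relation.Nullary.Decidable using (toWitness; fromWitness)
open import Relation.Unary using (Decidable)

open +-*-Solver

sumℚ-++ : (xs ys : List ℚ) → sumℚ (xs ++ ys) ≡ sumℚ xs + sumℚ ys
sumℚ-++ []       ys = sym (ℚ.+-identityˡ (sumℚ ys))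
sumℚ-++ (x ∷ xs) ys = trans (cong (x +_) (sumℚ-++ xs ys)) (sym (ℚ.+-assoc x (sumℚ xs) (sumℚ ys)))

module _ {A : Set} where

  sumℚ-map-+ : (f g : A → ℚ) (xs : List A) →
               sumℚ (map (λ x → f x + g x) xs) ≡ sumℚ (map f xs) + sumℚ (map g xs)
  sumℚ-map-+ f g []       = refl
  sumℚ-map-+ f g (x ∷ xs) rewrite sumℚ-map-+ f g xs =
    solve 4 (λ a b c d → (a :+ b) :+ (c :+ d) := (a :+ c) :+ (b :+ d)) refl
      (f x) (g x) (sumℚ (map f xs)) (sumℚ (map g xs))

  sumℚ-map-sub : (f g : A → ℚ) (xs : List A) →
               sumℚ (map (λ x → f x - g x) xs) ≡ sumℚ (map f xs) - sumℚ (map g xs)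
  sumℚ-map-sub f g []       = refl
  sumℚ-map-sub f g (x ∷ xs) rewrite sumℚ-map-sub f g xs =
    solve 4 (λ a b c d → (a :- b) :+ (c :- d) := (a :+ c) :- (b :+ d)) refl
      (f x) (g x) (sumℚ (map f xs)) (sumℚ (map g xs))

  sumℚ-map-*ˡ : (c : ℚ) (f : A → ℚ) (xs : List A) →
                sumℚ (map (λ x → c * f x) xs) ≡ c * sumℚ (map f xs)
  sumℚ-map-*ˡ c f []       = sym (ℚ.*-zeroʳ c)
  sumℚ-map-*ˡ c f (x ∷ xs) rewrite sumℚ-map-*ˡ c f xs = sym (ℚ.*-distribˡ-+ c (f x) _)

  sumℚ-map-*ʳ : (c : ℚ) (f : A → ℚ) (xs : List A) →
                sumℚ (map (λ x → f x * c) xs) ≡ sumℚ (map f xs) * c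
  sumℚ-map-*ʳ c f []       = sym (ℚ.*-zeroˡ c)
  sumℚ-map-*ʳ c f (x ∷ xs) rewrite sumℚ-map-*ʳ c f xs = sym (ℚ.*-distribʳ-+ c (f x) _)

  sumℚ-map-zero : (f : A → ℚ) (xs : List A) → All (λ x → f x ≡ 0ℚ) xs → sumℚ (map f xs) ≡ 0ℚ
  sumℚ-map-zero f []       []         = refl
  sumℚ-map-zero f (x ∷ xs) (fx≡0 ∷ h) rewrite fx≡0 | sumℚ-map-zero f xs h = refl

  sumℚ-map-mono : (f g : A → ℚ) (xs : List A) → All (λ x → f x ≤ℚ g x) xs →
                  sumℚ (map f xs) ≤ℚ sumℚ (map g xs)
  sumℚ-map-mono f g []       []         = ℚ.≤-refl
  sumℚ-map-mono f g (x ∷ xs) (fx≤gx ∷ h) = ℚ.+-mono-≤ fx≤gx (sumℚ-map-mono f g xs h)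

  sumℚ-map-single : (f : A → ℚ) {x : A} {xs : List A} → Unique xs → x ∈ xs →
                    (∀ {y} → y ∈ xs → y ≢ x → f y ≡ 0ℚ) → sumℚ (map f xs) ≡ f x
  sumℚ-map-single f {xs = y ∷ ys} (y∉ys ∷ _) (here refl) off =
    trans (cong (f y +_) (sumℚ-map-zero f ys
            (All.tabulate (λ {z} z∈ys → off (there z∈ys) (λ z≡y → All.lookup y∉ys z∈ys (sym z≡y))))))
          (ℚ.+-identityʳ (f y))
  sumℚ-map-single f {x} {y ∷ ys} (y∉ys ∷ u) (there x∈ys) off =
    trans (cong₂ _+_ (off (here refl) (λ y≡x → All.lookup y∉ys x∈ys y≡x)) (sumℚ-map-single f u x∈ys (off ∘ there)))
          (ℚ.+-identityˡ (f x))

  prodℚ-map-* : (f g : A → ℚ) (xs : List A) →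
                prodℚ (map f xs) * prodℚ (map g xs) ≡ prodℚ (map (λ x → f x * g x) xs)
  prodℚ-map-* f g []       = refl
  prodℚ-map-* f g (x ∷ xs) rewrite sym (prodℚ-map-* f g xs) =
    solve 4 (λ a b c d → (a :* c) :* (b :* d) := (a :* b) :* (c :* d)) refl
      (f x) (g x) (prodℚ (map f xs)) (prodℚ (map g xs))

  prodℚ-map-zero : (f : A → ℚ) (xs : List A) → Any (λ x → f x ≡ 0ℚ) xs → prodℚ (map f xs) ≡ 0ℚ
  prodℚ-map-zero f (x ∷ xs) (here fx≡0) rewrite fx≡0 = ℚ.*-zeroˡ (prodℚ (map f xs))
  prodℚ-map-zero f (x ∷ xs) (there h)   rewrite prodℚ-map-zero f xs h = ℚ.*-zeroʳ (f x)

  prodℚ-map-sub-at : (f g h : A → ℚ) {a : A} {xs : List A} → Unique xs → a ∈ xs →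
    (∀ x → x ≢ a → f x ≡ h x) → (∀ x → x ≢ a → g x ≡ h x) → f a - g a ≡ h a →
    prodℚ (map f xs) - prodℚ (map g xs) ≡ prodℚ (map h xs)
  prodℚ-map-sub-at f g h {a} {a ∷ xs} (a∉xs ∷ _) (here refl) f≡h g≡h fa-ga≡ha = begin
    f a * prodℚ (map f xs) - g a * prodℚ (map g xs)
      ≡⟨ cong₂ (λ u w → f a * u - g a * w) (off-a f f≡h) (off-a g g≡h) ⟩
    f a * Πh - g a * Πh
      ≡⟨ solve 3 (λ u w z → u :* z :- w :* z := (u :- w) :* z) refl (f a) (g a) Πh ⟩
    (f a - g a) * Πh
      ≡⟨ cong (_* Πh) fa-ga≡ha ⟩
    h a * Πh ∎
    where
    open ≡-Reasoning
    Πh = prodℚ (map h xs)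
    off-a : (k : A → ℚ) → (∀ x → x ≢ a → k x ≡ h x) → prodℚ (map k xs) ≡ Πh
    off-a k k≡h = cong prodℚ (map-cong-local (All.map (λ {y} a≢y → k≡h y (a≢y ∘ sym)) a∉xs))
  prodℚ-map-sub-at f g h {a} {x ∷ xs} (x∉xs ∷ !xs) (there a∈xs) f≡h g≡h fa-ga≡ha = begin
    f x * prodℚ (map f xs) - g x * prodℚ (map g xs)
      ≡⟨ cong₂ (λ u w → u * prodℚ (map f xs) - w * prodℚ (map g xs)) (f≡h x x≢a) (g≡h x x≢a) ⟩
    h x * prodℚ (map f xs) - h x * prodℚ (map g xs)
      ≡⟨ solve 3 (λ u w z → u :* w :- u :* z := u :* (w :- z)) refl (h x) (prodℚ (map f xs)) (prodℚ (map g xs)) ⟩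
    h x * (prodℚ (map f xs) - prodℚ (map g xs))
      ≡⟨ cong (h x *_) (prodℚ-map-sub-at f g h !xs a∈xs f≡h g≡h fa-ga≡ha) ⟩
    h x * prodℚ (map h xs) ∎
    where
    open ≡-Reasoning
    x≢a : x ≢ a
    x≢a = All.lookup x∉xs a∈xs

module _ {A B : Set} where

  sumℚ-map-swap : (f : A → B → ℚ) (xs : List A) (ys : List B) →
    sumℚ (map (λ x → sumℚ (map (f x) ys)) xs) ≡ sumℚ (map (λ y → sumℚ (map (λ x → f x y) xs)) ys)
  sumℚ-map-swap f []       ys = sym (sumℚ-map-zero _ ys (All.tabulate (λ _ → refl)))
  sumℚ-map-swap f (x ∷ xs) ys rewrite sumℚ-map-swap f xs ys =
    sym (sumℚ-map-+ (f x) (λ y → sumℚ (map (λ x → f x y) xs)) ys)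

T-ext : ∀ {a b} → (T a → T b) → (T b → T a) → a ≡ b
T-ext {true}  {true}  _ _ = refl
T-ext {true}  {false} a⇒b _ = ⊥-elim (a⇒b _)
T-ext {false} {true}  _ b⇒a = ⊥-elim (b⇒a _)
T-ext {false} {false} _ _ = refl

count : {A : Set} → (A → Bool) → List A → ℕ
count q []       = 0
count q (x ∷ xs) = if q x then suc (count q xs) else count q xs

module _ {A : Set} where

  count-mono : {q r : A → Bool} → (∀ x → T (q x) → T (r x)) → ∀ xs → count q xs ≤ count r xs
  count-mono {q} {r} q⇒r []       = z≤n
  count-mono {q} {r} q⇒r (x ∷ xs) with q x in qx | r x in rx
  ... | true  | true  = s≤s (count-mono q⇒r xs)
  ... | true  | false = ⊥-elim (subst T rx (q⇒r x (Equivalence.from T-≡ qx)))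
  ... | false | true  = ℕ.m≤n⇒m≤1+n (count-mono q⇒r xs)
  ... | false | false = count-mono q⇒r xs

  count-none : (q : A → Bool) (xs : List A) → All (λ x → ¬ T (q x)) xs → count q xs ≡ 0
  count-none q []       []           = refl
  count-none q (x ∷ xs) (¬qx ∷ ¬qxs) with q x
  ... | true  = ⊥-elim (¬qx _)
  ... | false = count-none q xs ¬qxs

  count-true : (xs : List A) → count (λ _ → true) xs ≡ length xs
  count-true []       = refl
  count-true (x ∷ xs) = cong suc (count-true xs)

  count-++ : (q : A → Bool) (xs ys : List A) → count q (xs ++ ys) ≡ count q xs ℕ.+ count q ys
  count-++ q []       ys = refl
  count-++ q (x ∷ xs) ys with q x
  ... | true  = cong suc (count-++ q xs ys)
  ... | false = count-++ q xs ys

  count-filter-≤ : (q : A → Bool) {P : A → Set} (P? : Decidable P) (xs : List A) →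
                   count q (filter P? xs) ≤ count q xs
  count-filter-≤ q P? []       = z≤n
  count-filter-≤ q P? (x ∷ xs) with does (P? x)
  ... | true  with q x
  ...   | true  = s≤s (count-filter-≤ q P? xs)
  ...   | false = count-filter-≤ q P? xs
  count-filter-≤ q P? (x ∷ xs) | false with q x
  ...   | true  = ℕ.m≤n⇒m≤1+n (count-filter-≤ q P? xs)
  ...   | false = count-filter-≤ q P? xs

  count-deduplicate-≤ : (q : A → Bool) {R : A → A → Set} (R? : Decidable₂ R) (xs : List A) →
                        count q (deduplicate R? xs) ≤ count q xs
  count-deduplicate-≤ q R? []       = z≤n
  count-deduplicate-≤ q R? (x ∷ xs) with q x
  ... | true  = s≤s (ℕ.≤-trans (count-filter-≤ q _ (deduplicate R? xs)) (count-deduplicate-≤ q R? xs))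
  ... | false = ℕ.≤-trans (count-filter-≤ q _ (deduplicate R? xs)) (count-deduplicate-≤ q R? xs)

  count-∨-≤ : (q r : A → Bool) (xs : List A) → count (λ x → q x ∨ r x) xs ≤ count q xs ℕ.+ count r xs
  count-∨-≤ q r []       = z≤n
  count-∨-≤ q r (x ∷ xs) with q x | r x
  ... | true  | true  = s≤s (ℕ.≤-trans (count-∨-≤ q r xs) (ℕ.+-monoʳ-≤ (count q xs) (ℕ.n≤1+n _)))
  ... | true  | false = s≤s (count-∨-≤ q r xs)
  ... | false | true  = ℕ.≤-trans (s≤s (count-∨-≤ q r xs)) (ℕ.≤-reflexive (sym (ℕ.+-suc _ _)))
  ... | false | false = count-∨-≤ q r xs

  count-≤-∧-not : (q r : A → Bool) (xs : List A) → count q xs ≤ count (λ x → q x ∧ not (r x)) xs ℕ.+ count r xs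
  count-≤-∧-not q r []       = z≤n
  count-≤-∧-not q r (x ∷ xs) with q x | r x
  ... | true  | true  = ℕ.≤-trans (s≤s (count-≤-∧-not q r xs)) (ℕ.≤-reflexive (sym (ℕ.+-suc _ _)))
  ... | true  | false = s≤s (count-≤-∧-not q r xs)
  ... | false | true  = ℕ.≤-trans (count-≤-∧-not q r xs) (ℕ.+-monoʳ-≤ _ (ℕ.n≤1+n _))
  ... | false | false = count-≤-∧-not q r xs

  count-≤1 : {q : A → Bool} {a : A} → (∀ x → T (q x) → x ≡ a) → ∀ {xs} → Unique xs → count q xs ≤ 1
  count-≤1 {q} only-a {[]}     []           = z≤n
  count-≤1 {q} only-a {x ∷ xs} (x∉xs ∷ !xs) with q x in qx
  ... | false = count-≤1 only-a !xs
  ... | true  = s≤s (ℕ.≤-reflexive (count-none q xs (All.map ¬q x∉xs)))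
    where
    ¬q : ∀ {y} → x ≢ y → ¬ T (q y)
    ¬q x≢y qy = x≢y (trans (only-a x (Equivalence.from T-≡ qx)) (sym (only-a _ qy)))

  length≤count : {q : A → Bool} {xs ys : List A} → Unique xs → All (λ x → x ∈ ys × T (q x)) xs →
                 length xs ≤ count q ys
  length≤count {q} {[]}     []           []                = z≤n
  length≤count {q} {x ∷ xs} (x∉xs ∷ !xs) ((x∈ys , qx) ∷ h) =
    ℕ.≤-trans (s≤s (length≤count !xs
                (All.zipWith (λ (x≢y , y∈ys , qy) → ∈-remove x∈ys y∈ys (x≢y ∘ sym) , qy) (x∉xs , h))))
              (ℕ.≤-reflexive (sym (count-remove x∈ys qx)))
    where
    remove : ∀ {x ys} → x ∈ ys → List A
    remove {ys = y ∷ ys} (here _)    = ys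
    remove {ys = y ∷ ys} (there x∈ys) = y ∷ remove x∈ys

    count-remove : ∀ {x ys} (x∈ys : x ∈ ys) → T (q x) → count q ys ≡ suc (count q (remove x∈ys))
    count-remove {ys = y ∷ ys} (here refl) qx with q y
    ... | true = refl
    count-remove {ys = y ∷ ys} (there x∈ys) qx with q y
    ... | true  = cong suc (count-remove x∈ys qx)
    ... | false = count-remove x∈ys qx

    ∈-remove : ∀ {x z ys} (x∈ys : x ∈ ys) → z ∈ ys → z ≢ x → z ∈ remove x∈ys
    ∈-remove (here refl)  (here refl)  z≢x = ⊥-elim (z≢x refl)
    ∈-remove (here refl)  (there z∈ys) z≢x = z∈ys
    ∈-remove (there x∈ys) (here refl)  z≢x = here refl
    ∈-remove (there x∈ys) (there z∈ys) z≢x = there (∈-remove x∈ys z∈ys z≢x)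

  count-map : {B : Set} (q : B → Bool) (f : A → B) (xs : List A) → count q (map f xs) ≡ count (q ∘ f) xs
  count-map q f []       = refl
  count-map q f (x ∷ xs) with q (f x)
  ... | true  = cong suc (count-map q f xs)
  ... | false = count-map q f xs

  sum-map-≤ : (f : A → ℕ) {c : ℕ} (xs : List A) → (∀ x → f x ≤ c) → sum (map f xs) ≤ length xs ℕ.* c
  sum-map-≤ f []       f≤c = z≤n
  sum-map-≤ f (x ∷ xs) f≤c = ℕ.+-mono-≤ (f≤c x) (sum-map-≤ f xs f≤c)

  count-any-≤ : {B : Set} (q : B → A → Bool) (bs : List B) (xs : List A) →
                count (λ x → any (λ b → q b x) bs) xs ≤ sum (map (λ b → count (q b) xs) bs)
  count-any-≤ q []       xs = ℕ.≤-reflexive (count-none (λ _ → false) xs (All.tabulate (λ _ ())))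
  count-any-≤ q (b ∷ bs) xs =
    ℕ.≤-trans (count-∨-≤ (q b) _ xs) (ℕ.+-monoʳ-≤ (count (q b) xs) (count-any-≤ q bs xs))

module _ {X Y Z : Set} (h : X → Y → Z) where

  count-concatMap-map-≤ : {Q : Z → Bool} {q : X → Bool} {r : Y → Bool} →
    (∀ x y → T (Q (h x y)) → T (q x) × T (r y)) →
    ∀ xs ys → count Q (concatMap (λ x → map (h x) ys) xs) ≤ count q xs ℕ.* count r ys
  count-concatMap-map-≤ {Q} {q} {r} Q⇒qr []       ys = z≤n
  count-concatMap-map-≤ {Q} {q} {r} Q⇒qr (x ∷ xs) ys = begin
    count Q (map (h x) ys ++ concatMap (λ x → map (h x) ys) xs)
      ≡⟨ count-++ Q (map (h x) ys) _ ⟩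
    count Q (map (h x) ys) ℕ.+ count Q (concatMap (λ x → map (h x) ys) xs)
      ≤⟨ ℕ.+-mono-≤ (ℕ.≤-trans (ℕ.≤-reflexive (count-map Q (h x) ys)) row) (count-concatMap-map-≤ Q⇒qr xs ys) ⟩
    (if q x then count r ys else 0) ℕ.+ count q xs ℕ.* count r ys
      ≡⟨ add-row (q x) ⟩
    count q (x ∷ xs) ℕ.* count r ys ∎
    where
    open ℕ.≤-Reasoning
    row : count (Q ∘ h x) ys ≤ (if q x then count r ys else 0)
    row with q x in qx
    ... | true  = count-mono (λ y Qxy → proj₂ (Q⇒qr x y Qxy)) ys
    ... | false = ℕ.≤-reflexive
                    (count-none (Q ∘ h x) ys (All.tabulate (λ {y} _ Qxy → subst T qx (proj₁ (Q⇒qr x y Qxy)))))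
    add-row : ∀ b → (if b then count r ys else 0) ℕ.+ count q xs ℕ.* count r ys
                    ≡ (if b then suc (count q xs) else count q xs) ℕ.* count r ys
    add-row true  = refl
    add-row false = refl

*-nonNeg : ∀ {a b} → 0ℚ ≤ℚ a → 0ℚ ≤ℚ b → 0ℚ ≤ℚ a * b
*-nonNeg {a} {b} 0≤a 0≤b =
  ℚ.nonNegative⁻¹ (a * b) {{ℚ.nonNeg*nonNeg⇒nonNeg a {{nonNegative 0≤a}} b {{nonNegative 0≤b}}}}

*-mono-≤-nonNeg : ∀ {a b c d} → 0ℚ ≤ℚ a → 0ℚ ≤ℚ d → a ≤ℚ b → c ≤ℚ d → a * c ≤ℚ b * d
*-mono-≤-nonNeg {a} {b} {c} {d} 0≤a 0≤d a≤b c≤d =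
  ℚ.≤-trans (ℚ.*-monoˡ-≤-nonNeg a {{nonNegative 0≤a}} c≤d) (ℚ.*-monoʳ-≤-nonNeg d {{nonNegative 0≤d}} a≤b)

0≤1 : 0ℚ ≤ℚ 1ℚ
0≤1 = ℚ.nonNegative⁻¹ 1ℚ

module _ {p : ℚ} (0≤p : 0ℚ ≤ℚ p) where

  ^ℚ-nonNeg : ∀ m → 0ℚ ≤ℚ p ^ℚ m
  ^ℚ-nonNeg zero    = 0≤1
  ^ℚ-nonNeg (suc m) = *-nonNeg 0≤p (^ℚ-nonNeg m)

  module _ (p≤1 : p ≤ℚ 1ℚ) where

    ^ℚ-≤1 : ∀ m → p ^ℚ m ≤ℚ 1ℚ
    ^ℚ-≤1 zero    = ℚ.≤-refl
    ^ℚ-≤1 (suc m) = *-mono-≤-nonNeg 0≤p 0≤1 p≤1 (^ℚ-≤1 m)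

    ^ℚ-antitone : ∀ {a b} → a ≤ b → p ^ℚ b ≤ℚ p ^ℚ a
    ^ℚ-antitone {b = b} z≤n     = ^ℚ-≤1 b
    ^ℚ-antitone         (s≤s h) = ℚ.*-monoˡ-≤-nonNeg p {{nonNegative 0≤p}} (^ℚ-antitone h)

  prodℚ-map-≤-^ℚ : {A : Set} (f : A → ℚ) (q : A → Bool) → (∀ x → 0ℚ ≤ℚ f x) → (∀ x → f x ≤ℚ 1ℚ) →
                   (∀ x → T (q x) → f x ≤ℚ p) → ∀ xs → prodℚ (map f xs) ≤ℚ p ^ℚ count q xs
  prodℚ-map-≤-^ℚ f q 0≤f f≤1 f≤p []       = ℚ.≤-refl
  prodℚ-map-≤-^ℚ f q 0≤f f≤1 f≤p (x ∷ xs) with q x in qx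
  ... | true  = *-mono-≤-nonNeg (0≤f x) (^ℚ-nonNeg (count q xs)) (f≤p x (Equivalence.from T-≡ qx))
                                (prodℚ-map-≤-^ℚ f q 0≤f f≤1 f≤p xs)
  ... | false = ℚ.≤-trans (*-mono-≤-nonNeg (0≤f x) (^ℚ-nonNeg (count q xs)) (f≤1 x)
                                           (prodℚ-map-≤-^ℚ f q 0≤f f≤1 f≤p xs))
                          (ℚ.≤-reflexive (ℚ.*-identityˡ (p ^ℚ count q xs)))

fromℕℚ-suc : ∀ m → fromℕℚ (suc m) ≡ 1ℚ + fromℕℚ m
fromℕℚ-suc m = ℚ.toℚᵘ-injective (begin
  toℚᵘ (fromℕℚ (suc m))          ≈⟨ ℚ.toℚᵘ-fromℚᵘ (mkℚᵘ (ℤ.+ suc m) 0) ⟩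
  mkℚᵘ (ℤ.+ suc m) 0             ≈⟨ ℚᵘ.*≡* numerators ⟩
  toℚᵘ 1ℚ ℚᵘ.+ mkℚᵘ (ℤ.+ m) 0    ≈⟨ ℚᵘ.+-congʳ (toℚᵘ 1ℚ) (ℚᵘ.≃-sym (ℚ.toℚᵘ-fromℚᵘ (mkℚᵘ (ℤ.+ m) 0))) ⟩
  toℚᵘ 1ℚ ℚᵘ.+ toℚᵘ (fromℕℚ m)   ≈⟨ ℚᵘ.≃-sym (ℚ.toℚᵘ-homo-+ 1ℚ (fromℕℚ m)) ⟩
  toℚᵘ (1ℚ + fromℕℚ m)           ∎)
  where
  open import Relation.Binary.Reasoning.Setoid ℚᵘ.≃-setoid
  numerators : ℤ.+ suc m ℤ.* ℤ.+ 1 ≡ (ℤ.+ 1 ℤ.* ℤ.+ 1 ℤ.+ ℤ.+ m ℤ.* ℤ.+ 1) ℤ.* ℤ.+ 1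
  numerators = trans (ℤ.*-identityʳ (ℤ.+ suc m))
                     (sym (trans (ℤ.*-identityʳ _) (cong (ℤ._+_ (ℤ.+ 1)) (ℤ.*-identityʳ (ℤ.+ m)))))

fromℕℚ-+ : ∀ a b → fromℕℚ (a ℕ.+ b) ≡ fromℕℚ a + fromℕℚ b
fromℕℚ-+ zero    b = sym (ℚ.+-identityˡ (fromℕℚ b))
fromℕℚ-+ (suc a) b rewrite fromℕℚ-suc (a ℕ.+ b) | fromℕℚ-suc a | fromℕℚ-+ a b =
  sym (ℚ.+-assoc 1ℚ (fromℕℚ a) (fromℕℚ b))

fromℕℚ-* : ∀ a b → fromℕℚ (a ℕ.* b) ≡ fromℕℚ a * fromℕℚ b
fromℕℚ-* zero    b = sym (ℚ.*-zeroˡ (fromℕℚ b))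
fromℕℚ-* (suc a) b rewrite fromℕℚ-+ b (a ℕ.* b) | fromℕℚ-* a b | fromℕℚ-suc a =
  solve 2 (λ x y → y :+ x :* y := (con 1ℚ :+ x) :* y) refl (fromℕℚ a) (fromℕℚ b)

fromℕℚ-^ : ∀ a b → fromℕℚ (a ℕ.^ b) ≡ fromℕℚ a ^ℚ b
fromℕℚ-^ a zero    = refl
fromℕℚ-^ a (suc b) rewrite fromℕℚ-* a (a ℕ.^ b) | fromℕℚ-^ a b = refl

fromℕℚ-mono-≤ : ∀ {a b} → a ≤ b → fromℕℚ a ≤ℚ fromℕℚ b
fromℕℚ-mono-≤ {b = b} z≤n = ℚ.nonNegative⁻¹ (fromℕℚ b) {{ℚ.normalize-nonNeg b 1}}
fromℕℚ-mono-≤ {suc a} {suc b} (s≤s a≤b) rewrite fromℕℚ-suc a | fromℕℚ-suc b = ℚ.+-monoʳ-≤ 1ℚ (fromℕℚ-mono-≤ a≤b)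

sumℚ-map-indicator : {A : Set} (q : A → Bool) (c : ℚ) (xs : List A) →
                     sumℚ (map (λ x → if q x then c else 0ℚ) xs) ≡ fromℕℚ (count q xs) * c
sumℚ-map-indicator q c []       = sym (ℚ.*-zeroˡ c)
sumℚ-map-indicator q c (x ∷ xs) with q x
... | true  rewrite sumℚ-map-indicator q c xs | fromℕℚ-suc (count q xs) =
  solve 2 (λ c k → c :+ k :* c := (con 1ℚ :+ k) :* c) refl c (fromℕℚ (count q xs))
... | false rewrite sumℚ-map-indicator q c xs = ℚ.+-identityˡ _

module _ {A B : Set} (f : A → List B) (tag : B → A) (tag-f : ∀ {x y} → y ∈ f x → tag y ≡ x) where

  unique-concatMap : (∀ x → Unique (f x)) → ∀ {xs} → Unique xs → Unique (concatMap f xs)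
  unique-concatMap !f {[]}     []           = []
  unique-concatMap !f {x ∷ xs} (x∉xs ∷ !xs) = Unique.++⁺ (!f x) (unique-concatMap !f !xs) disjoint
    where
    disjoint : ∀ {y} → ¬ (y ∈ f x × y ∈ concatMap f xs)
    disjoint (y∈fx , y∈rest) with find (∈-concatMap⁻ f {xs = xs} y∈rest)
    ... | x′ , x′∈xs , y∈fx′ = All.lookup x∉xs x′∈xs (trans (sym (tag-f y∈fx)) (tag-f y∈fx′))

module _ {A B : Set} (f : A → B) where

  unique-map-on : ∀ {xs} → Unique xs → (∀ {x y} → x ∈ xs → y ∈ xs → f x ≡ f y → x ≡ y) → Unique (map f xs)
  unique-map-on {[]}     []           _   = []
  unique-map-on {x ∷ xs} (x∉xs ∷ !xs) inj =
    AllP.map⁺ (All.tabulate (λ {y} y∈xs fx≡fy → All.lookup x∉xs y∈xs (inj (here refl) (there y∈xs) fx≡fy)))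
    ∷ unique-map-on !xs (λ x∈xs y∈xs → inj (there x∈xs) (there y∈xs))

  zip-map-self : (xs : List A) → zip xs (map f xs) ≡ map (λ x → x , f x) xs
  zip-map-self []       = refl
  zip-map-self (x ∷ xs) = cong ((x , f x) ∷_) (zip-map-self xs)

Pair : ℕ → Set
Pair m = Fin m × Fin m

module _ {m : ℕ} {x y : Fin m} where

  ≡ᶠ⇒≡ : T (x ≡ᶠ y) → x ≡ y
  ≡ᶠ⇒≡ = toWitness

  ≡⇒≡ᶠ : x ≡ y → T (x ≡ᶠ y)
  ≡⇒≡ᶠ = fromWitness

module _ {m : ℕ} where

  -- The test by which graphOf and addEdge compare pairs, so that both compute under it.
  _==ₚ_ : Pair m → Pair m → Bool
  (a , b) ==ₚ (c , d) = (a ≡ᶠ c) ∧ (b ≡ᶠ d)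

  ==ₚ-refl : (e : Pair m) → (e ==ₚ e) ≡ true
  ==ₚ-refl (a , b) with a ≟ᶠ a | b ≟ᶠ b
  ... | yes _  | yes _  = refl
  ... | yes _  | no b≢b = ⊥-elim (b≢b refl)
  ... | no a≢a | _      = ⊥-elim (a≢a refl)

  ==ₚ-≢ : {e e′ : Pair m} → e ≢ e′ → (e ==ₚ e′) ≡ false
  ==ₚ-≢ {a , b} {c , d} e≢e′ with a ≟ᶠ c | b ≟ᶠ d
  ... | yes refl | yes refl = ⊥-elim (e≢e′ refl)
  ... | yes _    | no _     = refl
  ... | no _     | _        = refl

  ==ₚ-sound : {e e′ : Pair m} → T (e ==ₚ e′) → e ≡ e′
  ==ₚ-sound {a , b} {c , d} t with a ≟ᶠ c | b ≟ᶠ d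
  ... | yes refl | yes refl = refl
  ... | yes _    | no _     = ⊥-elim t
  ... | no _     | _        = ⊥-elim t

  Pairs-∈⁺ : {a b : Fin m} → toℕ a ℕ.< toℕ b → (a , b) ∈ Pairs m
  Pairs-∈⁺ {a} {b} a<b =
    ∈-concatMap⁺ row (lose (∈-allFin a) (∈-map⁺ (a ,_) (∈-filter⁺ (λ c → toℕ a ℕ.<? toℕ c) (∈-allFin b) a<b)))
    where row = λ a → map (a ,_) (filter (λ c → toℕ a ℕ.<? toℕ c) (allFin m))

  Pairs-∈⁻ : {e : Pair m} → e ∈ Pairs m → toℕ (proj₁ e) ℕ.< toℕ (proj₂ e)
  Pairs-∈⁻ e∈P with find (∈-concatMap⁻ row {xs = allFin m} e∈P)
    where row = λ a → map (a ,_) (filter (λ c → toℕ a ℕ.<? toℕ c) (allFin m))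
  ... | a , _ , e∈row with ∈-map⁻ (a ,_) e∈row
  ... | b , b∈filter , refl = proj₂ (∈-filter⁻ (λ c → toℕ a ℕ.<? toℕ c) {xs = allFin m} b∈filter)

  Pairs-unique : Unique (Pairs m)
  Pairs-unique = unique-concatMap row proj₁ tag-row
    (λ a → Unique.map⁺ (cong proj₂) (Unique.filter⁺ _ (Unique.allFin⁺ m))) (Unique.allFin⁺ m)
    where
    row = λ a → map (a ,_) (filter (λ c → toℕ a ℕ.<? toℕ c) (allFin m))
    tag-row : ∀ {a} {e : Pair m} → e ∈ row a → proj₁ e ≡ a
    tag-row {a} e∈row with ∈-map⁻ (a ,_) e∈row
    ... | _ , _ , refl = refl

  Joins : Pair m → Fin m → Fin m → Set
  Joins e x y = e ≡ (x , y) ⊎ e ≡ (y , x)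

  sortPair : Fin m → Fin m → Pair m
  sortPair x y with toℕ x ℕ.<? toℕ y
  ... | yes _ = x , y
  ... | no  _ = y , x

  sortPair-joins : (x y : Fin m) → Joins (sortPair x y) x y
  sortPair-joins x y with toℕ x ℕ.<? toℕ y
  ... | yes _ = inj₁ refl
  ... | no  _ = inj₂ refl

  sortPair-∈-Pairs : {x y : Fin m} → x ≢ y → sortPair x y ∈ Pairs m
  sortPair-∈-Pairs {x} {y} x≢y with toℕ x ℕ.<? toℕ y
  ... | yes x<y = Pairs-∈⁺ x<y
  ... | no  x≮y = Pairs-∈⁺ (ℕ.≤∧≢⇒< (ℕ.≮⇒≥ x≮y) (λ y≡x → x≢y (sym (toℕ-injective y≡x))))

  _∈ₚ_ : Fin m → Pair m → Set
  a ∈ₚ e = proj₁ e ≡ a ⊎ proj₂ e ≡ a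

  ∈ₚ⇒T : ∀ {a} {e : Pair m} → a ∈ₚ e → T ((proj₁ e ≡ᶠ a) ∨ (proj₂ e ≡ᶠ a))
  ∈ₚ⇒T (inj₁ e₁≡a) = Equivalence.from T-∨ (inj₁ (≡⇒≡ᶠ e₁≡a))
  ∈ₚ⇒T (inj₂ e₂≡a) = Equivalence.from T-∨ (inj₂ (≡⇒≡ᶠ e₂≡a))

  T⇒∈ₚ : ∀ {a} {e : Pair m} → T ((proj₁ e ≡ᶠ a) ∨ (proj₂ e ≡ᶠ a)) → a ∈ₚ e
  T⇒∈ₚ t with Equivalence.to T-∨ t
  ... | inj₁ t₁ = inj₁ (≡ᶠ⇒≡ t₁)
  ... | inj₂ t₂ = inj₂ (≡ᶠ⇒≡ t₂)

  Joins⇒∈ₚ : ∀ {e : Pair m} {x y} → Joins e x y → x ∈ₚ e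
  Joins⇒∈ₚ (inj₁ refl) = inj₁ refl
  Joins⇒∈ₚ (inj₂ refl) = inj₂ refl

  Joins-sym : ∀ {e : Pair m} {x y} → Joins e x y → Joins e y x
  Joins-sym (inj₁ e≡xy) = inj₂ e≡xy
  Joins-sym (inj₂ e≡yx) = inj₁ e≡yx

  ∈ₚ-Joins : ∀ {e : Pair m} {x y a} → Joins e x y → a ∈ₚ e → a ≡ x ⊎ a ≡ y
  ∈ₚ-Joins (inj₁ refl) (inj₁ refl) = inj₁ refl
  ∈ₚ-Joins (inj₁ refl) (inj₂ refl) = inj₂ refl
  ∈ₚ-Joins (inj₂ refl) (inj₁ refl) = inj₂ refl
  ∈ₚ-Joins (inj₂ refl) (inj₂ refl) = inj₁ refl

  Joins-unique : ∀ {e : Pair m} {x y x′ y′} → Joins e x y → Joins e x′ y′ → (x ≡ x′ × y ≡ y′) ⊎ (x ≡ y′ × y ≡ x′)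
  Joins-unique (inj₁ refl) (inj₁ refl) = inj₁ (refl , refl)
  Joins-unique (inj₁ refl) (inj₂ refl) = inj₂ (refl , refl)
  Joins-unique (inj₂ refl) (inj₁ refl) = inj₂ (refl , refl)
  Joins-unique (inj₂ refl) (inj₂ refl) = inj₁ (refl , refl)

-- Expectation over G(n,p)

sublists-All : {A : Set} {P : A → Set} {xs : List A} → All P xs → All (All P) (sublists xs)
sublists-All []         = [] ∷ []
sublists-All (px ∷ pxs) = AllP.++⁺ (AllP.map⁺ (All.map (px ∷_) (sublists-All pxs))) (sublists-All pxs)

module _ {A : Set} (_==_ : A → A → Bool) (==-refl : ∀ x → (x == x) ≡ true)
         (==-≢ : ∀ {x y} → x ≢ y → (x == y) ≡ false) where

  any-==-false : ∀ {x L} → All (_≢ x) L → any (_== x) L ≡ false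
  any-==-false []            = refl
  any-==-false (z≢x ∷ L≢x) rewrite ==-≢ z≢x = any-==-false L≢x

  sumℚ-sublists-prodℚ : (h : A → Bool → ℚ) → ∀ {xs} → Unique xs →
    sumℚ (map (λ L → prodℚ (map (λ x → h x (any (_== x) L)) xs)) (sublists xs))
      ≡ prodℚ (map (λ x → h x true + h x false) xs)
  sumℚ-sublists-prodℚ h {[]}     []           = ℚ.+-identityʳ 1ℚ
  sumℚ-sublists-prodℚ h {x ∷ xs} (x∉xs ∷ !xs) = begin
    sumℚ (map F (map (x ∷_) Ls ++ Ls))
      ≡⟨ cong sumℚ (map-++ F (map (x ∷_) Ls) Ls) ⟩
    sumℚ (map F (map (x ∷_) Ls) ++ map F Ls)
      ≡⟨ sumℚ-++ (map F (map (x ∷_) Ls)) (map F Ls) ⟩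
    sumℚ (map F (map (x ∷_) Ls)) + sumℚ (map F Ls)
      ≡⟨ cong₂ _+_ (cong sumℚ (trans (sym (map-∘ Ls)) (map-cong F-with-x Ls)))
                   (cong sumℚ (map-cong-local (All.map F-without-x (sublists-All x∉xs)))) ⟩
    sumℚ (map (λ L → h x true * Π L) Ls) + sumℚ (map (λ L → h x false * Π L) Ls)
      ≡⟨ cong₂ _+_ (sumℚ-map-*ˡ (h x true) Π Ls) (sumℚ-map-*ˡ (h x false) Π Ls) ⟩
    h x true * sumℚ (map Π Ls) + h x false * sumℚ (map Π Ls)
      ≡⟨ sym (ℚ.*-distribʳ-+ (sumℚ (map Π Ls)) (h x true) (h x false)) ⟩
    (h x true + h x false) * sumℚ (map Π Ls)
      ≡⟨ cong ((h x true + h x false) *_) (sumℚ-sublists-prodℚ h !xs) ⟩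
    (h x true + h x false) * prodℚ (map (λ x → h x true + h x false) xs) ∎
    where
    open ≡-Reasoning
    Ls = sublists xs
    F Π : List A → ℚ
    F L = prodℚ (map (λ y → h y (any (_== y) L)) (x ∷ xs))
    Π L = prodℚ (map (λ y → h y (any (_== y) L)) xs)
    F-with-x : ∀ L → F (x ∷ L) ≡ h x true * Π L
    F-with-x L rewrite ==-refl x =
      cong (h x true *_) (cong prodℚ (map-cong-local
        (All.map (λ {y} x≢y → cong (λ b → h y (b ∨ any (_== y) L)) (==-≢ x≢y)) x∉xs)))
    F-without-x : ∀ {L} → All (x ≢_) L → F L ≡ h x false * Π L
    F-without-x {L} x∉L rewrite any-==-false (All.map (λ x≢z → x≢z ∘ sym) x∉L) = refl

mean : ℚ → (Bool → ℚ) → ℚ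
mean p g = p * g true + (1ℚ - p) * g false

module _ {n : ℕ} {p : ℚ} where

  𝔼-cong : {X Y : Graph n → ℚ} → (∀ G → X G ≡ Y G) → 𝔼 n p X ≡ 𝔼 n p Y
  𝔼-cong X≗Y = cong sumℚ (map-cong (λ G → cong (probG p G *_) (X≗Y G)) (allGraphs n))

  𝔼-sumℚ : {A : Set} (X : A → Graph n → ℚ) (cs : List A) →
           𝔼 n p (λ G → sumℚ (map (λ c → X c G) cs)) ≡ sumℚ (map (λ c → 𝔼 n p (X c)) cs)
  𝔼-sumℚ X cs = trans (cong sumℚ (map-cong (λ G → sym (sumℚ-map-*ˡ (probG p G) (λ c → X c G) cs)) (allGraphs n)))
                      (sumℚ-map-swap (λ G c → probG p G * X c G) (allGraphs n) cs)

  𝔼-prodℚ : (g : Pair n → Bool → ℚ) →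
            𝔼 n p (λ G → prodℚ (map (λ e → g e (I G e)) (Pairs n))) ≡ prodℚ (map (λ e → mean p (g e)) (Pairs n))
  𝔼-prodℚ g = begin
    sumℚ (map (λ G → probG p G * X G) (map graphOf (sublists (Pairs n))))
      ≡⟨ cong sumℚ (sym (map-∘ (sublists (Pairs n)))) ⟩
    sumℚ (map (λ L → probG p (graphOf L) * X (graphOf L)) (sublists (Pairs n)))
      ≡⟨ cong sumℚ (map-cong (λ L → prodℚ-map-* _ _ (Pairs n)) (sublists (Pairs n))) ⟩
    sumℚ (map (λ L → prodℚ (map (λ e → h e (I (graphOf L) e)) (Pairs n))) (sublists (Pairs n)))
      ≡⟨ sumℚ-sublists-prodℚ _==ₚ_ ==ₚ-refl ==ₚ-≢ h Pairs-unique ⟩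
    prodℚ (map (λ e → mean p (g e)) (Pairs n)) ∎
    where
    open ≡-Reasoning
    X : Graph n → ℚ
    X G = prodℚ (map (λ e → g e (I G e)) (Pairs n))
    h : Pair n → Bool → ℚ
    h e b = (if b then p else 1ℚ - p) * g e b

-- Copies of F

module _ {A : Set} (_≟_ : DecidableEquality A) {w : ℕ} (f : Fin (3 ℕ.+ w) → A)
         (f-inj : ∀ {a b} → a ≢ b → f a ≢ f b) (i j : A) where

  injection-avoids-two : ∃[ c ] f c ≢ i × f c ≢ j
  injection-avoids-two with f zero ≟ i | f zero ≟ j
  ... | no f0≢i | no f0≢j = zero , f0≢i , f0≢j
  ... | yes f0≡i | _ with f (suc zero) ≟ j
  ...   | no f1≢j  = suc zero , (λ f1≡i → f-inj (λ ()) (trans f0≡i (sym f1≡i))) , f1≢j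
  ...   | yes f1≡j = suc (suc zero) , (λ f2≡i → f-inj (λ ()) (trans f0≡i (sym f2≡i)))
                                    , (λ f2≡j → f-inj (λ ()) (trans f1≡j (sym f2≡j)))
  injection-avoids-two | no _ | yes f0≡j with f (suc zero) ≟ i
  ...   | no f1≢i  = suc zero , f1≢i , (λ f1≡j → f-inj (λ ()) (trans f0≡j (sym f1≡j)))
  ...   | yes f1≡i = suc (suc zero) , (λ f2≡i → f-inj (λ ()) (trans f1≡i (sym f2≡i)))
                                    , (λ f2≡j → f-inj (λ ()) (trans f0≡j (sym f2≡j)))

module _ {n : ℕ} where

  coveredBy : (Pair n → Bool) → Fin n → Bool
  coveredBy σ a = any (λ e → σ e ∧ ((proj₁ e ≡ᶠ a) ∨ (proj₂ e ≡ᶠ a))) (Pairs n)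

  normalForm : (Pair n → Bool) → Copy n
  normalForm σ = map (coveredBy σ) (allFin n) , map σ (Pairs n)

  normalForm-cong : {σ σ′ : Pair n → Bool} → All (λ e → σ e ≡ σ′ e) (Pairs n) → normalForm σ ≡ normalForm σ′
  normalForm-cong σ≡σ′ = cong₂ _,_
    (map-cong (λ a → cong or (map-cong-local (All.map (cong (_∧ _)) σ≡σ′))) (allFin n))
    (map-cong-local σ≡σ′)

hits : ∀ {v n} → Fin n → Fin n → (Fin v → Fin n) → Bool
hits {v} i j φ = any (λ a → any (λ b → (φ a ≡ᶠ i) ∧ (φ b ≡ᶠ j)) (allFin v)) (allFin v)

hits⁺ : ∀ {v n} {i j : Fin n} (φ : Fin v → Fin n) (a b : Fin v) → φ a ≡ i → φ b ≡ j → T (hits i j φ)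
hits⁺ φ a b φa≡i φb≡j =
  any⁺ _ (lose (∈-allFin a) (any⁺ _ (lose (∈-allFin b) (Equivalence.from T-∧ (≡⇒≡ᶠ φa≡i , ≡⇒≡ᶠ φb≡j)))))

module _ {v : ℕ} (F : SimpleGraph v) where

  edgesF-∈⁺ : {f : Pair v} → f ∈ Pairs v → T (adj F (proj₁ f) (proj₂ f)) → f ∈ edgesF F
  edgesF-∈⁺ = ∈-filter⁺ (λ e → T? (adj F (proj₁ e) (proj₂ e)))

  edgesF-∈⁻ : {f : Pair v} → f ∈ edgesF F → f ∈ Pairs v × T (adj F (proj₁ f) (proj₂ f))
  edgesF-∈⁻ = ∈-filter⁻ (λ e → T? (adj F (proj₁ e) (proj₂ e))) {xs = Pairs v}

  adj⇒≢ : ∀ {c d} → T (adj F c d) → c ≢ d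
  adj⇒≢ {c} t refl = subst T (irrefl F c) t

  adj-Joins : ∀ {f : Pair v} {c d} → Joins f c d → T (adj F c d) → T (adj F (proj₁ f) (proj₂ f))
  adj-Joins             (inj₁ refl) t = t
  adj-Joins {c = c} {d} (inj₂ refl) t = subst T (SimpleGraph.sym F c d) t

  module _ {n : ℕ} (φ : Fin v → Fin n) where

    mapPair : Pair v → Pair n
    mapPair f = φ (proj₁ f) , φ (proj₂ f)

    imageEdges : Pair n → Bool
    imageEdges e = any (λ f → (mapPair f ==ₚ e) ∨ (mapPair f ==ₚ swap e)) (edgesF F)

    Joins-mapPair : ∀ {f : Pair v} {c d} {e : Pair n} →
                    Joins f c d → Joins e (φ c) (φ d) → Joins e (φ (proj₁ f)) (φ (proj₂ f))
    Joins-mapPair (inj₁ refl) e-joins = e-joins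
    Joins-mapPair (inj₂ refl) e-joins = Joins-sym e-joins

    imageEdges⁺ : ∀ {f e} → f ∈ edgesF F → Joins e (φ (proj₁ f)) (φ (proj₂ f)) → T (imageEdges e)
    imageEdges⁺ {f} f∈F e-joins = any⁺ _ (lose f∈F (Equivalence.from T-∨ (orient e-joins)))
      where
      orient : ∀ {e} → Joins e (φ (proj₁ f)) (φ (proj₂ f)) → T (mapPair f ==ₚ e) ⊎ T (mapPair f ==ₚ swap e)
      orient (inj₁ refl) = inj₁ (Equivalence.from T-≡ (==ₚ-refl (mapPair f)))
      orient (inj₂ refl) = inj₂ (Equivalence.from T-≡ (==ₚ-refl (mapPair f)))

    imageEdges⁻ : ∀ {e} → T (imageEdges e) → ∃[ f ] f ∈ edgesF F × Joins e (φ (proj₁ f)) (φ (proj₂ f))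
    imageEdges⁻ {e} t with find (any⁻ _ (edgesF F) t)
    ... | f , f∈F , t′ with Equivalence.to T-∨ t′
    ...   | inj₁ t₁ = f , f∈F , inj₁ (sym (==ₚ-sound t₁))
    ...   | inj₂ t₂ = f , f∈F , inj₂ (cong swap (sym (==ₚ-sound t₂)))

    imageEdges⇒hits : ∀ {i j} → T (imageEdges (i , j)) → T (hits i j φ)
    imageEdges⇒hits t with imageEdges⁻ t
    ... | f , _ , inj₁ ij≡ = hits⁺ φ (proj₁ f) (proj₂ f) (sym (cong proj₁ ij≡)) (sym (cong proj₂ ij≡))
    ... | f , _ , inj₂ ij≡ = hits⁺ φ (proj₂ f) (proj₁ f) (sym (cong proj₁ ij≡)) (sym (cong proj₂ ij≡))

    module _ (φ-inj : T (isInjective φ)) where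

      isInjective⇒≢ : ∀ {a b} → a ≢ b → φ a ≢ φ b
      isInjective⇒≢ {a} {b} a≢b φa≡φb =
        subst T (Equivalence.to T-not-≡ φ-inj)
          (any⁺ _ (lose (sortPair-∈-Pairs a≢b) (≡⇒≡ᶠ (collapse (sortPair-joins a b)))))
        where
        collapse : ∀ {s : Pair v} → Joins s a b → φ (proj₁ s) ≡ φ (proj₂ s)
        collapse (inj₁ refl) = φa≡φb
        collapse (inj₂ refl) = sym φa≡φb

      isInjective⇒injective : ∀ {a b} → φ a ≡ φ b → a ≡ b
      isInjective⇒injective {a} {b} φa≡φb with a ≟ᶠ b
      ... | yes a≡b = a≡b
      ... | no  a≢b = ⊥-elim (isInjective⇒≢ a≢b φa≡φb)

      imageEdges-adj : ∀ {c d} → T (adj F c d) → ∃[ e ] e ∈ Pairs n × T (imageEdges e) × Joins e (φ c) (φ d)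
      imageEdges-adj {c} {d} t =
        sortPair (φ c) (φ d) ,
        sortPair-∈-Pairs (isInjective⇒≢ (adj⇒≢ t)) ,
        imageEdges⁺ (edgesF-∈⁺ (sortPair-∈-Pairs (adj⇒≢ t)) (adj-Joins (sortPair-joins c d) t))
                    (Joins-mapPair (sortPair-joins c d) (sortPair-joins (φ c) (φ d))) ,
        sortPair-joins (φ c) (φ d)

      eF≤count-imageEdges : eF F ≤ count imageEdges (Pairs n)
      eF≤count-imageEdges = subst (_≤ count imageEdges (Pairs n)) (length-map edgeImage (edgesF F))
        (length≤count (unique-map-on edgeImage (Unique.filter⁺ _ Pairs-unique) edgeImage-injective)
                      (AllP.map⁺ (All.tabulate (λ {f} f∈F →
                         sortPair-∈-Pairs (isInjective⇒≢ (adj⇒≢ (proj₂ (edgesF-∈⁻ f∈F)))) ,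
                         imageEdges⁺ f∈F (sortPair-joins _ _)))))
        where
        edgeImage : Pair v → Pair n
        edgeImage f = sortPair (φ (proj₁ f)) (φ (proj₂ f))
        edgeImage-injective : ∀ {f f′} → f ∈ edgesF F → f′ ∈ edgesF F → edgeImage f ≡ edgeImage f′ → f ≡ f′
        edgeImage-injective {f} {f′} f∈F f′∈F eq
          with Joins-unique (sortPair-joins (φ (proj₁ f)) (φ (proj₂ f)))
                            (subst (λ e → Joins e (φ (proj₁ f′)) (φ (proj₂ f′))) (sym eq) (sortPair-joins _ _))
        ... | inj₁ (φ₁≡ , φ₂≡) = cong₂ _,_ (isInjective⇒injective φ₁≡) (isInjective⇒injective φ₂≡)
        ... | inj₂ (φ₁≡ , φ₂≡) = ⊥-elim (ℕ.<-asym (Pairs-∈⁻ (proj₁ (edgesF-∈⁻ f∈F)))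
          (subst₂ (λ a b → toℕ a ℕ.< toℕ b) (sym (isInjective⇒injective φ₂≡)) (sym (isInjective⇒injective φ₁≡))
                  (Pairs-∈⁻ (proj₁ (edgesF-∈⁻ f′∈F)))))

      module _ (no-isolated : NoIsolatedVertices F) where

        imageEdges-at : (c : Fin v) → ∃[ e ] e ∈ Pairs n × T (imageEdges e) × φ c ∈ₚ e
        imageEdges-at c with no-isolated c
        ... | d , adj≡true with imageEdges-adj (Equivalence.from T-≡ adj≡true)
        ...   | e , e∈P , t , e-joins = e , e∈P , t , Joins⇒∈ₚ e-joins

        -- Without isolated vertices, the vertex set of a copy is the set of endpoints of its edges.
        image-≡ : image F φ ≡ normalForm imageEdges
        image-≡ = cong (_, map imageEdges (Pairs n)) (map-cong vertex-covered (allFin n))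
          where
          vertex-covered : ∀ a → any (λ c → φ c ≡ᶠ a) (allFin v) ≡ coveredBy imageEdges a
          vertex-covered a = T-ext to from
            where
            to : T (any (λ c → φ c ≡ᶠ a) (allFin v)) → T (coveredBy imageEdges a)
            to t with find (any⁻ _ (allFin v) t)
            ... | c , _ , φc≡a with imageEdges-at c
            ...   | e , e∈P , te , φc∈e =
              any⁺ _ (lose e∈P (Equivalence.from T-∧ (te , ∈ₚ⇒T (subst (_∈ₚ e) (≡ᶠ⇒≡ φc≡a) φc∈e))))
            from : T (coveredBy imageEdges a) → T (any (λ c → φ c ≡ᶠ a) (allFin v))
            from t with find (any⁻ _ (Pairs n) t)
            ... | e , _ , t′ with Equivalence.to T-∧ t′
            ...   | te , t-end with imageEdges⁻ te
            ...     | f , _ , e-joins with ∈ₚ-Joins e-joins (T⇒∈ₚ t-end)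
            ...       | inj₁ a≡φf₁ = any⁺ _ (lose (∈-allFin (proj₁ f)) (≡⇒≡ᶠ (sym a≡φf₁)))
            ...       | inj₂ a≡φf₂ = any⁺ _ (lose (∈-allFin (proj₂ f)) (≡⇒≡ᶠ (sym a≡φf₂)))

        imageEdges-avoiding : ∀ {i j} (c : Fin v) → φ c ≢ i → φ c ≢ j →
                              ∃[ e ] e ∈ Pairs n × T (imageEdges e) × e ≢ (i , j)
        imageEdges-avoiding c φc≢i φc≢j with imageEdges-at c
        ... | e , e∈P , te , φc∈e =
          e , e∈P , te , λ e≡ij → [ φc≢i ∘ sym , φc≢j ∘ sym ] (subst (φ c ∈ₚ_) e≡ij φc∈e)

-- The derivative S_ij

module Derivative {v n : ℕ} (p : ℚ) (F : SimpleGraph v) (i j : Fin n) where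

  edgeFactor : (Pair n → Bool) → Pair n → Bool → ℚ
  edgeFactor σ e b = if σ e then indℚ b - p else 1ℚ

  -- In ∂weight the factor of ij becomes (1 - p) - (0 - p) = 1 if ij is an edge of the copy
  -- and 1 - 1 = 0 otherwise; the other factors are unchanged.
  ∂factor : (Pair n → Bool) → Pair n → Bool → ℚ
  ∂factor σ e b = if e ==ₚ (i , j) then indℚ (σ e) else edgeFactor σ e b

  ∂weight : Copy n → Graph n → ℚ
  ∂weight c G = copyWeight p (addEdge G i j) c - copyWeight p (removeEdge G i j) c

  containsIJ : Copy n → Bool
  containsIJ c = any (λ eb → (proj₁ eb ==ₚ (i , j)) ∧ proj₂ eb) (zip (Pairs n) (proj₂ c))

  Sij-≡ : ∀ G → Sij p F G i j ≡ sumℚ (map (λ c → ∂weight c G) (copies F n))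
  Sij-≡ G = sym (sumℚ-map-sub (copyWeight p (addEdge G i j)) (copyWeight p (removeEdge G i j)) (copies F n))

  Sij²-≡ : ∀ G → Sij p F G i j * Sij p F G i j
                 ≡ sumℚ (map (λ c → sumℚ (map (λ c′ → ∂weight c G * ∂weight c′ G) (copies F n))) (copies F n))
  Sij²-≡ G = begin
    Sij p F G i j * Sij p F G i j
      ≡⟨ cong₂ _*_ (Sij-≡ G) (Sij-≡ G) ⟩
    sumℚ (map (λ c → ∂weight c G) C) * sumℚ (map (λ c → ∂weight c G) C)
      ≡⟨ sumℚ-map-*ʳ _ (λ c → ∂weight c G) C ⟨
    sumℚ (map (λ c → ∂weight c G * sumℚ (map (λ c′ → ∂weight c′ G) C)) C)
      ≡⟨ cong sumℚ (map-cong (λ c → sumℚ-map-*ˡ (∂weight c G) (λ c′ → ∂weight c′ G) C) C) ⟨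
    sumℚ (map (λ c → sumℚ (map (λ c′ → ∂weight c G * ∂weight c′ G) C)) C) ∎
    where
    open ≡-Reasoning
    C = copies F n

  copyWeight-≡ : ∀ σ vs G →
    copyWeight p G (vs , map σ (Pairs n)) ≡ prodℚ (map (λ e → edgeFactor σ e (I G e)) (Pairs n))
  copyWeight-≡ σ vs G = cong prodℚ (trans (cong (map _) (zip-map-self σ (Pairs n))) (sym (map-∘ (Pairs n))))

  copies-are-images : All (λ c → ∃[ φ ] T (isInjective φ) × c ≡ image F φ) (copies F n)
  copies-are-images = AllP.deduplicate⁺ _ (AllP.map⁺ (All.map (λ {φ} φ-inj → φ , φ-inj , refl)
                        (AllP.all-filter (λ φ → T? (isInjective φ)) (allMaps v n))))

  mean-∂factor-off-ij : ∀ σ e → T (σ e) → e ≢ (i , j) → mean p (∂factor σ e) ≡ 0ℚ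
  mean-∂factor-off-ij σ e σe e≢ij rewrite ==ₚ-≢ e≢ij with σ e
  ... | true  = solve 1 (λ p → p :* (con 1ℚ :- p) :+ (con 1ℚ :- p) :* (con 0ℚ :- p) := con 0ℚ) refl p
  ... | false = ⊥-elim σe

  mean-∂factor-*-differ : ∀ σ σ′ e → σ e ≢ σ′ e → mean p (λ b → ∂factor σ e b * ∂factor σ′ e b) ≡ 0ℚ
  mean-∂factor-*-differ σ σ′ e σe≢σ′e with e ==ₚ (i , j) | σ e | σ′ e
  ... | _     | true  | true  = ⊥-elim (σe≢σ′e refl)
  ... | _     | false | false = ⊥-elim (σe≢σ′e refl)
  ... | true  | true  | false =
    solve 1 (λ p → p :* (con 1ℚ :* con 0ℚ) :+ (con 1ℚ :- p) :* (con 1ℚ :* con 0ℚ) := con 0ℚ) refl p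
  ... | true  | false | true  =
    solve 1 (λ p → p :* (con 0ℚ :* con 1ℚ) :+ (con 1ℚ :- p) :* (con 0ℚ :* con 1ℚ) := con 0ℚ) refl p
  ... | false | true  | false =
    solve 1 (λ p → p :* ((con 1ℚ :- p) :* con 1ℚ) :+ (con 1ℚ :- p) :* ((con 0ℚ :- p) :* con 1ℚ) := con 0ℚ) refl p
  ... | false | false | true  =
    solve 1 (λ p → p :* (con 1ℚ :* (con 1ℚ :- p)) :+ (con 1ℚ :- p) :* (con 1ℚ :* (con 0ℚ :- p)) := con 0ℚ) refl p

  mean-∂factor² : ∀ σ e → mean p (λ b → ∂factor σ e b * ∂factor σ e b)
                          ≡ (if e ==ₚ (i , j) then indℚ (σ e) else (if σ e then p * (1ℚ - p) else 1ℚ))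
  mean-∂factor² σ e with e ==ₚ (i , j) | σ e
  ... | true  | true  =
    solve 1 (λ p → p :* (con 1ℚ :* con 1ℚ) :+ (con 1ℚ :- p) :* (con 1ℚ :* con 1ℚ) := con 1ℚ) refl p
  ... | true  | false =
    solve 1 (λ p → p :* (con 0ℚ :* con 0ℚ) :+ (con 1ℚ :- p) :* (con 0ℚ :* con 0ℚ) := con 0ℚ) refl p
  ... | false | true  =
    solve 1 (λ p → p :* ((con 1ℚ :- p) :* (con 1ℚ :- p)) :+ (con 1ℚ :- p) :* ((con 0ℚ :- p) :* (con 0ℚ :- p))
                   := p :* (con 1ℚ :- p)) refl p
  ... | false | false =
    solve 1 (λ p → p :* (con 1ℚ :* con 1ℚ) :+ (con 1ℚ :- p) :* (con 1ℚ :* con 1ℚ) := con 1ℚ) refl p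

  mean-∂factor²-ij : ∀ σ → σ (i , j) ≡ false → mean p (λ b → ∂factor σ (i , j) b * ∂factor σ (i , j) b) ≡ 0ℚ
  mean-∂factor²-ij σ σij≡false rewrite mean-∂factor² σ (i , j) | ==ₚ-refl (i , j) | σij≡false = refl

  module _ (0≤p : 0ℚ ≤ℚ p) (p≤1 : p ≤ℚ 1ℚ) where

    p[1-p]≤p : p * (1ℚ - p) ≤ℚ p
    p[1-p]≤p = ℚ.≤-trans (ℚ.*-monoˡ-≤-nonNeg p {{nonNegative 0≤p}} 1-p≤1) (ℚ.≤-reflexive (ℚ.*-identityʳ p))
      where
      1-p≤1 : 1ℚ - p ≤ℚ 1ℚ
      1-p≤1 = ℚ.≤-trans (ℚ.+-monoʳ-≤ 1ℚ (ℚ.neg-antimono-≤ 0≤p)) (ℚ.≤-reflexive (ℚ.+-identityʳ 1ℚ))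

    0≤p[1-p] : 0ℚ ≤ℚ p * (1ℚ - p)
    0≤p[1-p] = *-nonNeg 0≤p (ℚ.≤-trans (ℚ.≤-reflexive (sym (ℚ.+-inverseʳ p))) (ℚ.+-monoˡ-≤ (- p) p≤1))

    mean-∂factor²-bounds : ∀ σ e → let t = mean p (λ b → ∂factor σ e b * ∂factor σ e b) in
      0ℚ ≤ℚ t × t ≤ℚ 1ℚ × (T (σ e ∧ not (e ==ₚ (i , j))) → t ≤ℚ p)
    mean-∂factor²-bounds σ e rewrite mean-∂factor² σ e with e ==ₚ (i , j) | σ e
    ... | true  | true  = 0≤1 , ℚ.≤-refl , λ ()
    ... | true  | false = ℚ.≤-refl , 0≤1 , λ ()
    ... | false | true  = 0≤p[1-p] , ℚ.≤-trans p[1-p]≤p p≤1 , λ _ → p[1-p]≤p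
    ... | false | false = 0≤1 , ℚ.≤-refl , λ ()

  count-off-ij : ∀ σ → eF F ≤ count σ (Pairs n) → eF F ∸ 1 ≤ count (λ e → σ e ∧ not (e ==ₚ (i , j))) (Pairs n)
  count-off-ij σ eF≤count = ℕ.≤-trans (ℕ.∸-monoˡ-≤ 1 eF≤c+1) (ℕ.≤-reflexive (ℕ.m+n∸n≡m _ 1))
    where
    eF≤c+1 : eF F ≤ count (λ e → σ e ∧ not (e ==ₚ (i , j))) (Pairs n) ℕ.+ 1
    eF≤c+1 = ℕ.≤-trans eF≤count (ℕ.≤-trans (count-≤-∧-not σ (_==ₚ (i , j)) (Pairs n))
               (ℕ.+-monoʳ-≤ _ (count-≤1 {a = i , j} (λ _ → ==ₚ-sound) (Pairs-unique {n}))))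

  module _ (ij∈P : (i , j) ∈ Pairs n) where

    ∂weight-≡ : ∀ σ vs G →
      ∂weight (vs , map σ (Pairs n)) G ≡ prodℚ (map (λ e → ∂factor σ e (I G e)) (Pairs n))
    ∂weight-≡ σ vs G = trans (cong₂ _-_ (copyWeight-≡ σ vs (addEdge G i j)) (copyWeight-≡ σ vs (removeEdge G i j)))
      (prodℚ-map-sub-at _ _ _ Pairs-unique ij∈P (off-ij true) (off-ij false) at-ij)
      where
      off-ij : ∀ b e → e ≢ (i , j) → edgeFactor σ e (if e ==ₚ (i , j) then b else I G e) ≡ ∂factor σ e (I G e)
      off-ij b e e≢ij rewrite ==ₚ-≢ e≢ij = refl
      at-ij : edgeFactor σ (i , j) (I (addEdge G i j) (i , j)) - edgeFactor σ (i , j) (I (removeEdge G i j) (i , j))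
              ≡ ∂factor σ (i , j) (I G (i , j))
      at-ij rewrite ==ₚ-refl (i , j) with σ (i , j)
      ... | true  = solve 1 (λ p → (con 1ℚ :- p) :- (con 0ℚ :- p) := con 1ℚ) refl p
      ... | false = ℚ.+-inverseʳ 1ℚ

    𝔼-∂weight : ∀ σ vs →
      𝔼 n p (∂weight (vs , map σ (Pairs n))) ≡ prodℚ (map (λ e → mean p (∂factor σ e)) (Pairs n))
    𝔼-∂weight σ vs = trans (𝔼-cong (∂weight-≡ σ vs)) (𝔼-prodℚ (∂factor σ))

    𝔼-∂weight-* : ∀ σ σ′ vs vs′ →
      𝔼 n p (λ G → ∂weight (vs , map σ (Pairs n)) G * ∂weight (vs′ , map σ′ (Pairs n)) G)
        ≡ prodℚ (map (λ e → mean p (λ b → ∂factor σ e b * ∂factor σ′ e b)) (Pairs n))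
    𝔼-∂weight-* σ σ′ vs vs′ =
      trans (𝔼-cong (λ G → trans (cong₂ _*_ (∂weight-≡ σ vs G) (∂weight-≡ σ′ vs′ G)) (prodℚ-map-* _ _ (Pairs n))))
            (𝔼-prodℚ (λ e b → ∂factor σ e b * ∂factor σ′ e b))

    𝔼-∂weight²-≤ : 0ℚ ≤ℚ p → p ≤ℚ 1ℚ → ∀ σ vs → eF F ≤ count σ (Pairs n) →
      𝔼 n p (λ G → ∂weight (vs , map σ (Pairs n)) G * ∂weight (vs , map σ (Pairs n)) G)
        ≤ℚ (if σ (i , j) then p ^ℚ (eF F ∸ 1) else 0ℚ)
    𝔼-∂weight²-≤ 0≤p p≤1 σ vs eF≤count rewrite 𝔼-∂weight-* σ σ vs vs with σ (i , j) in σij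
    ... | true  = ℚ.≤-trans
      (prodℚ-map-≤-^ℚ 0≤p _ _ (proj₁ ∘ bounds) (proj₁ ∘ proj₂ ∘ bounds) (proj₂ ∘ proj₂ ∘ bounds) (Pairs n))
      (^ℚ-antitone 0≤p p≤1 (count-off-ij σ eF≤count))
      where bounds = mean-∂factor²-bounds 0≤p p≤1 σ
    ... | false = ℚ.≤-reflexive (prodℚ-map-zero _ (Pairs n) (lose ij∈P (mean-∂factor²-ij σ σij)))

    containsIJ-≡ : ∀ σ vs → containsIJ (vs , map σ (Pairs n)) ≡ σ (i , j)
    containsIJ-≡ σ vs = trans (cong (any _) (zip-map-self σ (Pairs n)))
                              (trans (cong or (sym (map-∘ (Pairs n)))) (T-ext to from))
      where
      to : T (any (λ e → (e ==ₚ (i , j)) ∧ σ e) (Pairs n)) → T (σ (i , j))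
      to t with find (any⁻ _ (Pairs n) t)
      ... | e , _ , t′ with Equivalence.to T-∧ t′
      ...   | e≡ij , σe = subst (T ∘ σ) (==ₚ-sound e≡ij) σe
      from : T (σ (i , j)) → T (any (λ e → (e ==ₚ (i , j)) ∧ σ e) (Pairs n))
      from σij = any⁺ _ (lose ij∈P (Equivalence.from T-∧ (Equivalence.from T-≡ (==ₚ-refl (i , j)) , σij)))

    count-containsIJ-≤ : count containsIJ (copies F n) ≤ count (hits i j) (allMaps v n)
    count-containsIJ-≤ = begin
      count containsIJ (copies F n)
        ≤⟨ count-deduplicate-≤ containsIJ _ (map (image F) (injections v n)) ⟩
      count containsIJ (map (image F) (injections v n))
        ≡⟨ count-map containsIJ (image F) (injections v n) ⟩
      count (containsIJ ∘ image F) (injections v n)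
        ≤⟨ count-filter-≤ _ _ (allMaps v n) ⟩
      count (containsIJ ∘ image F) (allMaps v n)
        ≤⟨ count-mono ij-in-image⇒hits (allMaps v n) ⟩
      count (hits i j) (allMaps v n) ∎
      where
      open ℕ.≤-Reasoning
      ij-in-image⇒hits : ∀ φ → T (containsIJ (image F φ)) → T (hits i j φ)
      ij-in-image⇒hits φ t = imageEdges⇒hits F φ (subst T (containsIJ-≡ (imageEdges F φ) (proj₁ (image F φ))) t)

    module _ (no-isolated : NoIsolatedVertices F) where

      𝔼-∂weight-image : ∀ φ → T (isInjective φ) → ∀ c → φ c ≢ i → φ c ≢ j → 𝔼 n p (∂weight (image F φ)) ≡ 0ℚ
      𝔼-∂weight-image φ φ-inj c φc≢i φc≢j with imageEdges-avoiding F φ φ-inj no-isolated c φc≢i φc≢j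
      ... | e , e∈P , σe , e≢ij =
        trans (𝔼-∂weight (imageEdges F φ) (proj₁ (image F φ)))
              (prodℚ-map-zero _ (Pairs n) (lose e∈P (mean-∂factor-off-ij (imageEdges F φ) e σe e≢ij)))

      𝔼-∂weight-orthogonal : ∀ φ φ′ → T (isInjective φ) → T (isInjective φ′) → image F φ′ ≢ image F φ →
        𝔼 n p (λ G → ∂weight (image F φ) G * ∂weight (image F φ′) G) ≡ 0ℚ
      𝔼-∂weight-orthogonal φ φ′ φ-inj φ′-inj images-differ
        with All.all? (λ e → imageEdges F φ e Bool.≟ imageEdges F φ′ e) (Pairs n)
      ... | yes same = ⊥-elim (images-differ (begin
        image F φ′                   ≡⟨ image-≡ F φ′ φ′-inj no-isolated ⟩
        normalForm (imageEdges F φ′) ≡⟨ normalForm-cong (All.map sym same) ⟩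
        normalForm (imageEdges F φ)  ≡⟨ image-≡ F φ φ-inj no-isolated ⟨
        image F φ                    ∎))
        where open ≡-Reasoning
      ... | no differ =
        trans (𝔼-∂weight-* (imageEdges F φ) (imageEdges F φ′) (proj₁ (image F φ)) (proj₁ (image F φ′)))
              (prodℚ-map-zero _ (Pairs n)
                 (Any.map (λ {e} → mean-∂factor-*-differ (imageEdges F φ) (imageEdges F φ′) e)
                          (AllP.¬All⇒Any¬ (λ e → imageEdges F φ e Bool.≟ imageEdges F φ′ e) (Pairs n) differ)))

      sumℚ-𝔼-∂weight-*-diagonal : ∀ {c} → c ∈ copies F n →
        sumℚ (map (λ c′ → 𝔼 n p (λ G → ∂weight c G * ∂weight c′ G)) (copies F n)) ≡ 𝔼 n p (λ G → ∂weight c G * ∂weight c G)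
      sumℚ-𝔼-∂weight-*-diagonal c∈C with All.lookup copies-are-images c∈C
      ... | φ , φ-inj , refl = sumℚ-map-single _ (deduplicate-! _ (map (image F) (injections v n))) c∈C off-diagonal
        where
        off-diagonal : ∀ {c′} → c′ ∈ copies F n → c′ ≢ image F φ →
                       𝔼 n p (λ G → ∂weight (image F φ) G * ∂weight c′ G) ≡ 0ℚ
        off-diagonal c′∈C c′≢c with All.lookup copies-are-images c′∈C
        ... | φ′ , φ′-inj , refl = 𝔼-∂weight-orthogonal φ φ′ φ-inj φ′-inj c′≢c

      𝔼-Sij≡0 : (∀ φ → T (isInjective φ) → ∃[ c ] φ c ≢ i × φ c ≢ j) → 𝔼 n p (λ G → Sij p F G i j) ≡ 0ℚ
      𝔼-Sij≡0 avoids = begin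
        𝔼 n p (λ G → Sij p F G i j)
          ≡⟨ 𝔼-cong Sij-≡ ⟩
        𝔼 n p (λ G → sumℚ (map (λ c → ∂weight c G) (copies F n)))
          ≡⟨ 𝔼-sumℚ ∂weight (copies F n) ⟩
        sumℚ (map (λ c → 𝔼 n p (∂weight c)) (copies F n))
          ≡⟨ sumℚ-map-zero _ (copies F n) (All.map mean-zero copies-are-images) ⟩
        0ℚ ∎
        where
        open ≡-Reasoning
        mean-zero : ∀ {c} → ∃[ φ ] T (isInjective φ) × c ≡ image F φ → 𝔼 n p (∂weight c) ≡ 0ℚ
        mean-zero (φ , φ-inj , refl) with avoids φ φ-inj
        ... | c , φc≢i , φc≢j = 𝔼-∂weight-image φ φ-inj c φc≢i φc≢j

      𝔼-Sij²-≡ : 𝔼 n p (λ G → Sij p F G i j * Sij p F G i j)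
                 ≡ sumℚ (map (λ c → 𝔼 n p (λ G → ∂weight c G * ∂weight c G)) (copies F n))
      𝔼-Sij²-≡ = begin
        𝔼 n p (λ G → Sij p F G i j * Sij p F G i j)
          ≡⟨ 𝔼-cong Sij²-≡ ⟩
        𝔼 n p (λ G → sumℚ (map (λ c → sumℚ (map (λ c′ → ∂weight c G * ∂weight c′ G) C)) C))
          ≡⟨ 𝔼-sumℚ (λ c G → sumℚ (map (λ c′ → ∂weight c G * ∂weight c′ G) C)) C ⟩
        sumℚ (map (λ c → 𝔼 n p (λ G → sumℚ (map (λ c′ → ∂weight c G * ∂weight c′ G) C))) C)
          ≡⟨ cong sumℚ (map-cong (λ c → 𝔼-sumℚ (λ c′ G → ∂weight c G * ∂weight c′ G) C) C) ⟩
        sumℚ (map (λ c → sumℚ (map (λ c′ → 𝔼 n p (λ G → ∂weight c G * ∂weight c′ G)) C)) C)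
          ≡⟨ cong sumℚ (map-cong-local (All.tabulate sumℚ-𝔼-∂weight-*-diagonal)) ⟩
        sumℚ (map (λ c → 𝔼 n p (λ G → ∂weight c G * ∂weight c G)) C) ∎
        where
        open ≡-Reasoning
        C = copies F n

      𝔼-Sij²-≤ : 0ℚ ≤ℚ p → p ≤ℚ 1ℚ →
        𝔼 n p (λ G → Sij p F G i j * Sij p F G i j) ≤ℚ fromℕℚ (count containsIJ (copies F n)) * p ^ℚ (eF F ∸ 1)
      𝔼-Sij²-≤ 0≤p p≤1 = begin
        𝔼 n p (λ G → Sij p F G i j * Sij p F G i j)
          ≡⟨ 𝔼-Sij²-≡ ⟩
        sumℚ (map (λ c → 𝔼 n p (λ G → ∂weight c G * ∂weight c G)) (copies F n))
          ≤⟨ sumℚ-map-mono _ _ (copies F n) (All.map bound copies-are-images) ⟩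
        sumℚ (map (λ c → if containsIJ c then p ^ℚ (eF F ∸ 1) else 0ℚ) (copies F n))
          ≡⟨ sumℚ-map-indicator containsIJ _ (copies F n) ⟩
        fromℕℚ (count containsIJ (copies F n)) * p ^ℚ (eF F ∸ 1) ∎
        where
        open ℚ.≤-Reasoning
        bound : ∀ {c} → ∃[ φ ] T (isInjective φ) × c ≡ image F φ →
                𝔼 n p (λ G → ∂weight c G * ∂weight c G) ≤ℚ (if containsIJ c then p ^ℚ (eF F ∸ 1) else 0ℚ)
        bound (φ , φ-inj , refl) rewrite containsIJ-≡ (imageEdges F φ) (proj₁ (image F φ)) =
          𝔼-∂weight²-≤ 0≤p p≤1 (imageEdges F φ) (proj₁ (image F φ)) (eF≤count-imageEdges F φ φ-inj)

-- Counting maps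

length-allFin : ∀ m → length (allFin m) ≡ m
length-allFin m = length-tabulate {n = m} (λ x → x)

module _ {n : ℕ} where

  count-allFin-≤ : (q : Fin n → Bool) → count q (allFin n) ≤ n
  count-allFin-≤ q = ℕ.≤-trans (count-mono (λ _ _ → _) (allFin n))
                               (ℕ.≤-reflexive (trans (count-true (allFin n)) (length-allFin n)))

  count-allFin-≡ᶠ : (i : Fin n) → count (_≡ᶠ i) (allFin n) ≤ 1
  count-allFin-≡ᶠ i = count-≤1 {a = i} (λ _ → ≡ᶠ⇒≡) (Unique.allFin⁺ n)

  count-allMaps-≤ : ∀ v → count (λ _ → true) (allMaps v n) ≤ n ℕ.^ v
  count-allMaps-≤ zero    = ℕ.≤-refl
  count-allMaps-≤ (suc v) =
    ℕ.≤-trans (count-concatMap-map-≤ _ {q = λ _ → true} {r = λ _ → true} (λ _ _ _ → _ , _) (allFin n) (allMaps v n))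
              (ℕ.*-mono-≤ (count-allFin-≤ _) (count-allMaps-≤ v))

  count-pinned-≤ : ∀ {v} (a : Fin (suc v)) (i : Fin n) → count (λ φ → φ a ≡ᶠ i) (allMaps (suc v) n) ≤ n ℕ.^ v
  count-pinned-≤ {v} zero i =
    ℕ.≤-trans (count-concatMap-map-≤ _ {q = _≡ᶠ i} {r = λ _ → true} (λ _ _ t → t , _) (allFin n) (allMaps v n))
              (ℕ.≤-trans (ℕ.*-mono-≤ (count-allFin-≡ᶠ i) (count-allMaps-≤ v)) (ℕ.≤-reflexive (ℕ.+-identityʳ _)))
  count-pinned-≤ {suc v} (suc a) i =
    ℕ.≤-trans (count-concatMap-map-≤ _ {q = λ _ → true} {r = λ ψ → ψ a ≡ᶠ i} (λ _ _ t → _ , t)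
                                     (allFin n) (allMaps (suc v) n))
              (ℕ.*-mono-≤ (count-allFin-≤ _) (count-pinned-≤ a i))

  count-pinned₂-≤ : ∀ {v} {a b : Fin (suc (suc v))} → a ≢ b → (i j : Fin n) →
                    count (λ φ → (φ a ≡ᶠ i) ∧ (φ b ≡ᶠ j)) (allMaps (suc (suc v)) n) ≤ n ℕ.^ v
  count-pinned₂-≤ {a = zero}  {zero}  a≢b i j = ⊥-elim (a≢b refl)
  count-pinned₂-≤ {v} {zero} {suc b} a≢b i j =
    ℕ.≤-trans (count-concatMap-map-≤ _ {q = _≡ᶠ i} {r = λ ψ → ψ b ≡ᶠ j} (λ _ _ → Equivalence.to T-∧)
                                     (allFin n) (allMaps (suc v) n))
              (ℕ.≤-trans (ℕ.*-mono-≤ (count-allFin-≡ᶠ i) (count-pinned-≤ b j)) (ℕ.≤-reflexive (ℕ.+-identityʳ _)))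
  count-pinned₂-≤ {v} {suc a} {zero} a≢b i j =
    ℕ.≤-trans (count-concatMap-map-≤ _ {q = _≡ᶠ j} {r = λ ψ → ψ a ≡ᶠ i} (λ _ _ → swap ∘ Equivalence.to T-∧)
                                     (allFin n) (allMaps (suc v) n))
              (ℕ.≤-trans (ℕ.*-mono-≤ (count-allFin-≡ᶠ j) (count-pinned-≤ a i)) (ℕ.≤-reflexive (ℕ.+-identityʳ _)))
  count-pinned₂-≤ {zero}  {suc zero} {suc zero} a≢b i j = ⊥-elim (a≢b refl)
  count-pinned₂-≤ {suc v} {suc a}    {suc b}    a≢b i j =
    ℕ.≤-trans (count-concatMap-map-≤ _ {q = λ _ → true} {r = λ ψ → (ψ a ≡ᶠ i) ∧ (ψ b ≡ᶠ j)} (λ _ _ t → _ , t)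
                                     (allFin n) (allMaps (suc (suc v)) n))
              (ℕ.*-mono-≤ (count-allFin-≤ _) (count-pinned₂-≤ (a≢b ∘ cong suc) i j))

  count-hits-≤ : ∀ {w} {i j : Fin n} → i ≢ j →
                 count (hits i j) (allMaps (suc (suc w)) n) ≤ suc (suc w) ℕ.* (suc (suc w) ℕ.* n ℕ.^ w)
  count-hits-≤ {w} {i} {j} i≢j = begin
    count (hits i j) maps
      ≤⟨ count-any-≤ (λ a φ → any (λ b → pinned a b φ) (allFin v)) (allFin v) maps ⟩
    sum (map (λ a → count (λ φ → any (λ b → pinned a b φ) (allFin v)) maps) (allFin v))
      ≤⟨ sum-map-≤ _ (allFin v) (λ a → ℕ.≤-trans (count-any-≤ (pinned a) (allFin v) maps)
                                                    (sum-map-≤ _ (allFin v) (count-pinned-pair a))) ⟩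
    length (allFin v) ℕ.* (length (allFin v) ℕ.* n ℕ.^ w)
      ≡⟨ cong (λ l → l ℕ.* (l ℕ.* n ℕ.^ w)) (length-allFin v) ⟩
    v ℕ.* (v ℕ.* n ℕ.^ w) ∎
    where
    open ℕ.≤-Reasoning
    v = suc (suc w)
    maps = allMaps v n
    pinned : Fin v → Fin v → (Fin v → Fin n) → Bool
    pinned a b φ = (φ a ≡ᶠ i) ∧ (φ b ≡ᶠ j)
    count-pinned-pair : ∀ a b → count (pinned a b) maps ≤ n ℕ.^ w
    count-pinned-pair a b with a ≟ᶠ b
    ... | no  a≢b  = count-pinned₂-≤ a≢b i j
    ... | yes refl = subst (_≤ n ℕ.^ w) (sym (count-none (pinned a a) maps (All.tabulate (λ {φ} _ → clash φ)))) z≤n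
      where
      clash : ∀ φ → ¬ T (pinned a a φ)
      clash φ t with Equivalence.to (T-∧ {φ a ≡ᶠ i}) t
      ... | φa≡i , φa≡j = i≢j (trans (sym (≡ᶠ⇒≡ φa≡i)) (≡ᶠ⇒≡ φa≡j))

lemma3p2 : (k : ℕ) → 3 ≤ k → (p : ℚ) → 0ℚ <ℚ p → p <ℚ 1ℚ → (n : ℕ) →
    ∀ {v} (F : SimpleGraph v) → NoIsolatedVertices F → 3 ≤ v → v ≤ k →
    (i j : Fin n) → i < j →
      (𝔼 n p (λ G → Sij p F G i j) ≡ 0ℚ)
      × (𝔼 n p (λ G → Sij p F G i j * Sij p F G i j)
           ≤ℚ fromℕℚ k ^ℚ 2 * p ^ℚ (eF F ∸ 1) * fromℕℚ n ^ℚ (v ∸ 2))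
lemma3p2 k _ p 0<p p<1 n {suc (suc (suc w))} F no-isolated (s≤s (s≤s (s≤s _))) v≤k i j i<j =
  𝔼-Sij≡0 ij∈P no-isolated avoids , (begin
    𝔼 n p (λ G → Sij p F G i j * Sij p F G i j)  ≤⟨ 𝔼-Sij²-≤ ij∈P no-isolated 0≤p (ℚ.<⇒≤ p<1) ⟩
    fromℕℚ (count containsIJ (copies F n)) * pᵉ  ≤⟨ ℚ.*-monoʳ-≤-nonNeg pᵉ {{nonNegative (^ℚ-nonNeg 0≤p (eF F ∸ 1))}}
                                                      (fromℕℚ-mono-≤ count-bound) ⟩
    fromℕℚ (k ℕ.* (k ℕ.* n ℕ.^ suc w)) * pᵉ      ≡⟨ rearrange ⟩
    fromℕℚ k ^ℚ 2 * pᵉ * fromℕℚ n ^ℚ suc w       ∎)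
  where
  open Derivative p F i j
  open ℚ.≤-Reasoning
  0≤p = ℚ.<⇒≤ 0<p
  pᵉ = p ^ℚ (eF F ∸ 1)
  ij∈P = Pairs-∈⁺ i<j
  avoids : ∀ φ → T (isInjective φ) → ∃[ c ] φ c ≢ i × φ c ≢ j
  avoids φ φ-inj = injection-avoids-two _≟ᶠ_ φ (isInjective⇒≢ F φ φ-inj) i j
  count-bound : count containsIJ (copies F n) ≤ k ℕ.* (k ℕ.* n ℕ.^ suc w)
  count-bound = ℕ.≤-trans (count-containsIJ-≤ ij∈P)
                  (ℕ.≤-trans (count-hits-≤ (<⇒≢ i<j)) (ℕ.*-mono-≤ v≤k (ℕ.*-monoˡ-≤ (n ℕ.^ suc w) v≤k)))
  rearrange : fromℕℚ (k ℕ.* (k ℕ.* n ℕ.^ suc w)) * pᵉ ≡ fromℕℚ k ^ℚ 2 * pᵉ * fromℕℚ n ^ℚ suc w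
  rearrange rewrite fromℕℚ-* k (k ℕ.* n ℕ.^ suc w) | fromℕℚ-* k (n ℕ.^ suc w) | fromℕℚ-^ n (suc w) =
    solve 3 (λ a b c → (a :* (a :* c)) :* b := (a :* (a :* con 1ℚ)) :* b :* c) refl (fromℕℚ k) pᵉ (fromℕℚ n ^ℚ suc w)
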